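{- Let $n\ge 3$, let $\gamma=0$ if $n$ is even and $\gamma=1$ if $n$ is odd, and let $H_n^4$ be any graph in $\mathscr{H}_n^4$. For $t\in\{0,1,\dots,\lfloor n/2\rfloor-1\}$ let $g_t=\lceil 2^{2t+2+\gamma}/3\rceil$. Then for every such $t$ and every integer $m$ with $2^{\lceil n/2\rceil+t}-g_t\le m\le 2^{\lceil n/2\rceil+t}$, $$\xi_m(H_n^4)\ge\xi_{2^{\lceil n/2\rceil+t}}(H_n^4).$$
   Context: The family $\mathscr{H}_n^4$ ($n\ge 2$): $\mathscr{H}_2^4=\{K_4\}$; for $n\ge 3$, a graph is in $\mathscr{H}_n^4$ iff (up to isomorphism) it is obtained from two vertex-disjoint graphs $G_0,G_1\in\mathscr{H}_{n-1}^4$ (not necessarily isomorphic) by adding an arbitrary perfect matching between them. Each member is $(n+1)$-regular with $2^n$ vertices. For $X\subseteq V(G)$, $\overline{X}=V(G)\setminus X$ and $[X,\overline{X}]$ is the set of edges with exactly one end in $X$. For $1\le m\le\lfloor |V(G)|/2\rfloor$, $\xi_m(G)=\min\{|[X,\overline{X}]| : |X|=m,\ G[X],G[\overline{X}]\text{ connected}\}$. -}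

module Defs where

open import Data.Nat using (ℕ; zero; suc; _+_; _*_; _^_; _≤_; _<_; ⌈_/2⌉; ⌊_/2⌋; _/_; _%_)
open import Data.Bool using (Bool; true; false; _∧_; not; if_then_else_; T)
open import Data.Fin using (Fin; splitAt; _≟_)
open import Data.Fin.Subset using (Subset; _∈_; _∉_; ∁; ∣_∣)
open import Data.Fin.Permutation using (Permutation; Permutation′; _⟨$⟩ʳ_)
open import Data.List using (List; map; allFin)
open import Data.Nat.ListAction using (sum)
open import Data.Sum using (_⊎_; inj₁; inj₂)
open import Data.Product using (Σ; _×_; _,_)
open import Relation.Nullary.Decidable using (⌊_⌋)
open import Relation.Binary.PropositionalEquality using (_≡_)

Graph : ℕ → Set
Graph N = Fin N → Fin N → Bool

K4 : Graph 4
K4 i j = not ⌊ i ≟ j ⌋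

-- Disjoint union of G0 (vertices inj₁ ·) and G1 (vertices inj₂ ·) on Fin (k + k),
-- plus the perfect matching  i ~ σ i  between G0 and G1.
joinMatch : ∀ {k} → Graph k → Graph k → Permutation′ k → Graph (k + k)
joinMatch {k} G0 G1 σ u v with splitAt k u | splitAt k v
... | inj₁ i | inj₁ j = G0 i j
... | inj₂ i | inj₂ j = G1 i j
... | inj₁ i | inj₂ j = ⌊ (σ ⟨$⟩ʳ i) ≟ j ⌋
... | inj₂ j | inj₁ i = ⌊ (σ ⟨$⟩ʳ i) ≟ j ⌋

IsoVia : ∀ {M N} → Permutation M N → Graph M → Graph N → Set
IsoVia π H G = ∀ u v → G (π ⟨$⟩ʳ u) (π ⟨$⟩ʳ v) ≡ H u v

data InH4 : (n : ℕ) → Graph (2 ^ n) → Set where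
  base : ∀ (G : Graph (2 ^ 2)) (π : Permutation 4 (2 ^ 2)) →
         IsoVia π K4 G → InH4 2 G
  step : ∀ {n} (G0 G1 : Graph (2 ^ n)) → InH4 n G0 → InH4 n G1 →
         (σ : Permutation′ (2 ^ n)) →
         (G : Graph (2 ^ suc n)) (π : Permutation (2 ^ n + 2 ^ n) (2 ^ suc n)) →
         IsoVia π (joinMatch G0 G1 σ) G → InH4 (suc n) G

-- Walks in the induced subgraph G[X]: every vertex after the start lies in X.
data PathIn {N : ℕ} (G : Graph N) (X : Subset N) : Fin N → Fin N → Set where
  here : ∀ {u} → PathIn G X u u
  next : ∀ {u v w} → T (G u v) → v ∈ X → PathIn G X v w → PathIn G X u w

ConnectedIn : ∀ {N} → Graph N → Subset N → Set
ConnectedIn G X = ∀ u v → u ∈ X → v ∈ X → PathIn G X u v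

mem : ∀ {N} → Subset N → Fin N → Bool
mem X u = Data.Vec.lookup X u
  where import Data.Vec

cutSize : ∀ {N} → Graph N → Subset N → ℕ
cutSize {N} G X =
  sum (map (λ u → sum (map (λ v → if mem X u ∧ not (mem X v) ∧ G u v then 1 else 0)
                           (allFin N)))
           (allFin N))

Admissible : ∀ {N} → Graph N → ℕ → Subset N → Set
Admissible G m X = ∣ X ∣ ≡ m × ConnectedIn G X × ConnectedIn G (∁ X)

IsXi : ∀ {N} → Graph N → ℕ → ℕ → Set
IsXi {N} G m k =
  Σ (Subset N) (λ X → Admissible G m X × cutSize G X ≡ k)
  × (∀ (X : Subset N) → Admissible G m X → k ≤ cutSize G X)

ceil3 : ℕ → ℕ
ceil3 x = (x + 2) / 3

γ : ℕ → ℕ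
γ n = n % 2

g : ℕ → ℕ → ℕ
g n t = ceil3 (2 ^ (2 * t + 2 + γ n))

-- Let e(X) be the number of edges inside X. Every member H of ℋ_n^4 is (n+1)-regular, so
-- |[X, X̄]| = (n+1)|X| − 2e(X). Define ex by ex m = C(m,2) for m ≤ 4 and
-- ex (2^{q+2} + x) = ex 2^{q+2} + ex x + x for x ≤ 2^{q+2}. Induction along the matching
-- construction, using the superadditivity ex a + ex b + min(a,b) ≤ ex (a+b), gives e(X) ≤ ex |X|,
-- hence |[X, X̄]| ≥ (n+1)m − 2 ex m for |X| = m. On the other side, descending into one half of
-- the construction down to level k = ⌈n/2⌉ + t gives a copy B of a member of ℋ_k^4 in which B and
-- its complement are connected and each vertex of B has k+1 neighbours in B, so
-- |[B, B̄]| ≤ (n−k)2^k. For m = 2^k − j the complement identity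
-- ex (2^k − j) + j(k+1) = ex 2^k + ex j turns the comparison into 2 ex j ≤ j(2t+1+γ), which holds
-- for j ≤ g_t = ⌈2^{2t+2+γ}/3⌉.

module Submission where

open import Defs
open import Data.Nat using (ℕ; zero; suc; _+_; _*_; _∸_; _^_; _≤_; _<_; _≤?_; _⊓_; z≤n; s≤s; z<s; _/_; _%_; ⌈_/2⌉; ⌊_/2⌋)
open import Data.Nat.Properties hiding (_≟_)
open import Data.Nat.DivMod using (+-distrib-/-∣ˡ; m*n/n≡m; /-monoˡ-≤)
open import Data.Nat.Divisibility using (divides-refl)
open import Data.Nat.Tactic.RingSolver using (solve-∀)
open import Data.Nat.ListAction using () renaming (sum to sumList)
open import Data.Bool using (Bool; true; false; _∧_; not; T; if_then_else_)
open import Data.Empty using (⊥; ⊥-elim)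
open import Data.Unit using (tt)
open import Data.Product using (Σ; _,_)
open import Data.Sum using (inj₁; inj₂; [_,_]′)
open import Data.Fin using (Fin; zero; suc; splitAt; join; _↑ˡ_; _↑ʳ_; _≟_)
open import Data.Fin.Properties using (splitAt-↑ˡ; splitAt-↑ʳ; join-splitAt)
open import Data.Fin.Permutation using (Permutation; Permutation′; _⟨$⟩ʳ_; _⟨$⟩ˡ_; inverseˡ; inverseʳ)
open import Data.Fin.Subset using (Subset; _∈_; ∣_∣)
open import Data.Vec using (lookup; tabulate; _∷_; [])
open import Data.Vec.Properties using (lookup∘tabulate; lookup-map; lookup⇒[]=; []=⇒lookup)
import Data.List as List
import Data.List.Properties as List
open import Function using (_∘_)
open import Relation.Nullary.Decidable using (⌊_⌋; yes; no; fromWitness; fromWitnessFalse)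
open import Relation.Nullary.Negation using (contradiction)
open import Relation.Binary.PropositionalEquality hiding (J)
open import Algebra.Properties.Semiring.Sum +-*-semiring
  using (sum-syntax; sum-cong-≗; ∑-distrib-+; ∑-comm; ∑-permute; *-distribˡ-sum)

-- The extremal function

-- The number of vertices of a member of ℋ_{q+2}^4.
size : ℕ → ℕ
size q = 2 ^ (2 + q)

size-suc : ∀ q → size (suc q) ≡ size q + size q
size-suc q = cong (size q +_) (+-identityʳ (size q))

size-mono : ∀ {q r} → q ≤ r → size q ≤ size r
size-mono q≤r = ^-monoʳ-≤ 2 (s≤s (s≤s q≤r))

m≤size[m] : ∀ m → m ≤ size m
m≤size[m] zero    = z≤n
m≤size[m] (suc m) = begin
  suc m               ≤⟨ s≤s (m≤size[m] m) ⟩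
  1 + size m          ≤⟨ +-monoˡ-≤ (size m) (m^n>0 2 (2 + m)) ⟩
  size m + size m     ≡⟨ size-suc m ⟨
  size (suc m)        ∎
  where open ≤-Reasoning

data Halves (q : ℕ) : ℕ → Set where
  lower : ∀ {x} → x ≤ size q → Halves q x
  upper : ∀ {x} → x ≤ size q → Halves q (size q + x)

halves : ∀ q {j} → j ≤ size (suc q) → Halves q j
halves q {j} j≤ with j ≤? size q
... | yes j≤P = lower j≤P
... | no  j≰P = subst (Halves q) (m+[n∸m]≡n (<⇒≤ (≰⇒> j≰P)))
                  (upper (m≤n+o⇒m∸n≤o j (size q) (subst (j ≤_) (size-suc q) j≤)))

-- The level q is fuel: exAt q m is only meant for m ≤ size q, and splits off the top bit of m.
exAt : ℕ → ℕ → ℕ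
exAt zero    m = m * (m ∸ 1) / 2
exAt (suc q) m with m ≤? size q
... | yes _ = exAt q m
... | no  _ = exAt q (size q) + exAt q (m ∸ size q) + (m ∸ size q)

ex : ℕ → ℕ
ex m = exAt m m

exAt-suc-low : ∀ {q m} → m ≤ size q → exAt (suc q) m ≡ exAt q m
exAt-suc-low {q} {m} m≤ with m ≤? size q
... | yes _   = refl
... | no  m≰ = contradiction m≤ m≰

exAt-suc-high : ∀ {q m} → size q < m → exAt (suc q) m ≡ exAt q (size q) + exAt q (m ∸ size q) + (m ∸ size q)
exAt-suc-high {q} {m} P<m with m ≤? size q
... | yes m≤ = contradiction m≤ (<⇒≱ P<m)
... | no  _  = refl

exAt-+ : ∀ d {q m} → m ≤ size q → exAt (d + q) m ≡ exAt q m
exAt-+ zero    m≤ = refl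
exAt-+ (suc d) {q} m≤ = trans (exAt-suc-low (≤-trans m≤ (size-mono (m≤n+m q d)))) (exAt-+ d m≤)

exAt≡ex : ∀ q {m} → m ≤ size q → exAt q m ≡ ex m
exAt≡ex q {m} m≤ = begin
  exAt q m        ≡⟨ exAt-+ m m≤ ⟨
  exAt (m + q) m  ≡⟨ cong (λ l → exAt l m) (+-comm m q) ⟩
  exAt (q + m) m  ≡⟨ exAt-+ q (m≤size[m] m) ⟩
  ex m            ∎
  where open ≡-Reasoning

ex-top : ∀ q {x} → x ≤ size q → ex (size q + x) ≡ ex (size q) + ex x + x
ex-top q {zero} _ = trans (cong ex (+-identityʳ (size q))) (sym (trans (+-identityʳ _) (+-identityʳ _)))
ex-top q {suc x} x≤ = begin
  ex (P + suc x)
    ≡⟨ exAt≡ex (suc q) (≤-trans (+-monoʳ-≤ P x≤) (≤-reflexive (sym (size-suc q)))) ⟨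
  exAt (suc q) (P + suc x)
    ≡⟨ exAt-suc-high (m<m+n P z<s) ⟩
  exAt q P + exAt q (P + suc x ∸ P) + (P + suc x ∸ P)
    ≡⟨ cong (λ y → exAt q P + exAt q y + y) (m+n∸m≡n P (suc x)) ⟩
  exAt q P + exAt q (suc x) + suc x
    ≡⟨ cong₂ (λ y z → y + z + suc x) (exAt≡ex q ≤-refl) (exAt≡ex q x≤) ⟩
  ex P + ex (suc x) + suc x
    ∎
  where
  open ≡-Reasoning
  P = size q

ex-size-suc : ∀ q → ex (size (suc q)) ≡ ex (size q) + ex (size q) + size q
ex-size-suc q = trans (cong ex (size-suc q)) (ex-top q ≤-refl)

ex-size : ∀ q → 2 * ex (size q) ≡ size q * (3 + q)
ex-size zero    = refl
ex-size (suc q) = begin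
  2 * ex (size (suc q))                       ≡⟨ cong (2 *_) (ex-size-suc q) ⟩
  2 * (ex P + ex P + P)                       ≡⟨ regroup (ex P) P ⟩
  2 * ex P + 2 * ex P + 2 * P                 ≡⟨ cong (λ y → y + y + 2 * P) (ex-size q) ⟩
  P * (3 + q) + P * (3 + q) + 2 * P           ≡⟨ regroup′ P q ⟩
  (P + P) * (4 + q)                           ≡⟨ cong (_* (4 + q)) (size-suc q) ⟨
  size (suc q) * (4 + q)                      ∎
  where
  open ≡-Reasoning
  P = size q
  regroup : ∀ e p → 2 * (e + e + p) ≡ 2 * e + 2 * e + 2 * p
  regroup = solve-∀
  regroup′ : ∀ p q → p * (3 + q) + p * (3 + q) + 2 * p ≡ (p + p) * (4 + q)
  regroup′ = solve-∀

2*ex-top : ∀ q {x} → x ≤ size q → 2 * ex (size q + x) ≡ size q * (3 + q) + 2 * ex x + (x + x)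
2*ex-top q {x} x≤P = begin
  2 * ex (P + x)                    ≡⟨ cong (2 *_) (ex-top q x≤P) ⟩
  2 * (ex P + ex x + x)             ≡⟨ regroup (ex P) (ex x) x ⟩
  2 * ex P + 2 * ex x + (x + x)     ≡⟨ cong (λ y → y + 2 * ex x + (x + x)) (ex-size q) ⟩
  P * (3 + q) + 2 * ex x + (x + x)  ∎
  where
  open ≡-Reasoning
  P = size q
  regroup : ∀ e f x → 2 * (e + f + x) ≡ 2 * e + 2 * f + (x + x)
  regroup = solve-∀

ex-complement : ∀ q w {v} → w + v ≡ size q → ex v + w * (3 + q) ≡ ex (size q) + ex w
ex-complement zero 0 refl = refl
ex-complement zero 1 refl = refl
ex-complement zero 2 refl = refl
ex-complement zero 3 refl = refl
ex-complement zero 4 refl = refl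
ex-complement (suc q) w {v} w+v≡ with halves q (≤-trans (m≤m+n w v) (≤-reflexive w+v≡))
... | lower w≤P = begin
  ex v + w * (4 + q)                 ≡⟨ cong (λ y → ex y + w * (4 + q)) v≡ ⟩
  ex (P + v′) + w * (4 + q)          ≡⟨ cong (_+ w * (4 + q)) (ex-top q (m∸n≤m P w)) ⟩
  ex P + ex v′ + v′ + w * (4 + q)    ≡⟨ regroup (ex P) (ex v′) v′ w q ⟩
  ex P + (ex v′ + w * (3 + q)) + (w + v′) ≡⟨ cong₂ (λ y z → ex P + y + z) (ex-complement q w w+v′≡) w+v′≡ ⟩
  ex P + (ex P + ex w) + P           ≡⟨ regroup′ (ex P) (ex w) P ⟩
  ex P + ex P + P + ex w             ≡⟨ cong (_+ ex w) (ex-size-suc q) ⟨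
  ex (size (suc q)) + ex w           ∎
  where
  open ≡-Reasoning
  P = size q
  v′ = P ∸ w
  regroup″ : ∀ w v p → w + v + p ≡ w + (p + v)
  regroup″ = solve-∀
  w+v′≡ : w + v′ ≡ P
  w+v′≡ = m+[n∸m]≡n w≤P
  v≡ : v ≡ P + v′
  v≡ = +-cancelˡ-≡ w v (P + v′) (begin
    w + v          ≡⟨ trans w+v≡ (size-suc q) ⟩
    P + P          ≡⟨ cong (_+ P) w+v′≡ ⟨
    w + v′ + P     ≡⟨ regroup″ w v′ P ⟩
    w + (P + v′)   ∎)
  regroup : ∀ e f v w q → e + f + v + w * (4 + q) ≡ e + (f + w * (3 + q)) + (w + v)
  regroup = solve-∀
  regroup′ : ∀ e f p → e + (e + f) + p ≡ e + e + p + f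
  regroup′ = solve-∀
... | upper {w′} w′≤P = begin
  ex v + (P + w′) * (4 + q)                   ≡⟨ regroup (ex v) P w′ q ⟩
  ex v + w′ * (3 + q) + w′ + P * (3 + q) + P
    ≡⟨ cong₂ (λ y z → y + w′ + z + P) (ex-complement q w′ w′+v≡) (sym (ex-size q)) ⟩
  ex P + ex w′ + w′ + 2 * ex P + P            ≡⟨ regroup′ (ex P) (ex w′) w′ P ⟩
  (ex P + ex P + P) + (ex P + ex w′ + w′)     ≡⟨ cong₂ _+_ (ex-size-suc q) (ex-top q w′≤P) ⟨
  ex (size (suc q)) + ex (P + w′)             ∎
  where
  open ≡-Reasoning
  P = size q
  w′+v≡ : w′ + v ≡ P
  w′+v≡ = +-cancelˡ-≡ P (w′ + v) P (trans (sym (+-assoc P w′ v)) (trans w+v≡ (size-suc q)))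
  regroup : ∀ e p w q → e + (p + w) * (4 + q) ≡ e + w * (3 + q) + w + p * (3 + q) + p
  regroup = solve-∀
  regroup′ : ∀ e f w p → e + f + w + 2 * e + p ≡ (e + e + p) + (e + f + w)
  regroup′ = solve-∀

SuperadditiveUpTo : ℕ → Set
SuperadditiveUpTo q = ∀ {a b} → b ≤ a → a ≤ size q → ex a + ex b + b ≤ ex (a + b)

ex-+-≤ : ∀ q → SuperadditiveUpTo q → ∀ {x y} → x ≤ size q → y ≤ size q → ex x + ex y ≤ ex (x + y)
ex-+-≤ q sup {x} {y} x≤ y≤ with ≤-total y x
... | inj₁ y≤x = ≤-trans (m≤m+n _ y) (sup y≤x x≤)
... | inj₂ x≤y = begin
  ex x + ex y       ≡⟨ +-comm (ex x) (ex y) ⟩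
  ex y + ex x       ≤⟨ m≤m+n _ x ⟩
  ex y + ex x + x   ≤⟨ sup x≤y y≤ ⟩
  ex (y + x)        ≡⟨ cong ex (+-comm y x) ⟩
  ex (x + y)        ∎
  where open ≤-Reasoning

ex-superadditive-base : SuperadditiveUpTo 0
ex-superadditive-base {0} {0} _ _ = z≤n
ex-superadditive-base {1} {0} _ _ = z≤n
ex-superadditive-base {1} {1} _ _ = ≤ᵇ⇒≤ _ _ _
ex-superadditive-base {2} {0} _ _ = ≤ᵇ⇒≤ _ _ _
ex-superadditive-base {2} {1} _ _ = ≤ᵇ⇒≤ _ _ _
ex-superadditive-base {2} {2} _ _ = ≤ᵇ⇒≤ _ _ _
ex-superadditive-base {3} {0} _ _ = ≤ᵇ⇒≤ _ _ _
ex-superadditive-base {3} {1} _ _ = ≤ᵇ⇒≤ _ _ _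
ex-superadditive-base {3} {2} _ _ = ≤ᵇ⇒≤ _ _ _
ex-superadditive-base {3} {3} _ _ = ≤ᵇ⇒≤ _ _ _
ex-superadditive-base {4} {0} _ _ = ≤ᵇ⇒≤ _ _ _
ex-superadditive-base {4} {1} _ _ = ≤ᵇ⇒≤ _ _ _
ex-superadditive-base {4} {2} _ _ = ≤ᵇ⇒≤ _ _ _
ex-superadditive-base {4} {3} _ _ = ≤ᵇ⇒≤ _ _ _
ex-superadditive-base {4} {4} _ _ = ≤ᵇ⇒≤ _ _ _
ex-superadditive-base {0} {suc _} () _
ex-superadditive-base {1} {suc (suc _)} (s≤s ()) _
ex-superadditive-base {2} {suc (suc (suc _))} (s≤s (s≤s ())) _
ex-superadditive-base {3} {suc (suc (suc (suc _)))} (s≤s (s≤s (s≤s ()))) _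
ex-superadditive-base {4} {suc (suc (suc (suc (suc _))))} (s≤s (s≤s (s≤s (s≤s ())))) _
ex-superadditive-base {suc (suc (suc (suc (suc _))))} _ (s≤s (s≤s (s≤s (s≤s ()))))

complements-sum : ∀ {p a b} → a ≤ p → b ≤ p → p ≤ a + b → (p ∸ b) + (p ∸ a) + (a + b ∸ p) ≡ p
complements-sum {p} {a} {b} a≤p b≤p p≤a+b = +-cancelˡ-≡ p _ _ (begin
  p + (u + v + y)      ≡⟨ regroup p u v y ⟩
  p + y + (u + v)      ≡⟨ cong (_+ (u + v)) (m+[n∸m]≡n p≤a+b) ⟩
  a + b + (u + v)      ≡⟨ regroup′ a b u v ⟩
  (b + u) + (a + v)    ≡⟨ cong₂ _+_ (m+[n∸m]≡n b≤p) (m+[n∸m]≡n a≤p) ⟩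
  p + p                ∎)
  where
  open ≡-Reasoning
  u = p ∸ b
  v = p ∸ a
  y = a + b ∸ p
  regroup : ∀ p u v y → p + (u + v + y) ≡ p + y + (u + v)
  regroup = solve-∀
  regroup′ : ∀ a b u v → a + b + (u + v) ≡ (b + u) + (a + v)
  regroup′ = solve-∀

module _ (q : ℕ) (sup : SuperadditiveUpTo q) where
  private
    P = size q

  ex-superadditive-upper-lower : ∀ {a′ b} → a′ ≤ P → b ≤ P → a′ + b ≤ P →
                                 ex (P + a′) + ex b + b ≤ ex (P + a′ + b)
  ex-superadditive-upper-lower {a′} {b} a′≤P b≤P s≤P = begin
    ex (P + a′) + ex b + b                ≡⟨ cong (λ y → y + ex b + b) (ex-top q a′≤P) ⟩
    ex P + ex a′ + a′ + ex b + b          ≡⟨ regroup (ex P) (ex a′) a′ (ex b) b ⟩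
    ex P + (ex a′ + ex b) + (a′ + b)      ≤⟨ +-monoˡ-≤ (a′ + b) (+-monoʳ-≤ (ex P) (ex-+-≤ q sup a′≤P b≤P)) ⟩
    ex P + ex (a′ + b) + (a′ + b)         ≡⟨ ex-top q s≤P ⟨
    ex (P + (a′ + b))                     ≡⟨ cong ex (+-assoc P a′ b) ⟨
    ex (P + a′ + b)                       ∎
    where
    open ≤-Reasoning
    regroup : ∀ e f a g b → e + f + a + g + b ≡ e + (f + g) + (a + b)
    regroup = solve-∀

  ex-superadditive-upper-upper : ∀ {a′ b′} → b′ ≤ a′ → a′ ≤ P →
                                 ex (P + a′) + ex (P + b′) + (P + b′) ≤ ex (P + a′ + (P + b′))
  ex-superadditive-upper-upper {a′} {b′} b′≤a′ a′≤P = begin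
    ex (P + a′) + ex (P + b′) + (P + b′)
      ≡⟨ cong₂ (λ y z → y + z + (P + b′)) (ex-top q a′≤P) (ex-top q b′≤P) ⟩
    ex P + ex a′ + a′ + (ex P + ex b′ + b′) + (P + b′)
      ≡⟨ regroup (ex P) (ex a′) a′ (ex b′) b′ P ⟩
    (ex P + ex P + P) + (ex a′ + ex b′ + b′) + (a′ + b′)
      ≤⟨ +-monoˡ-≤ (a′ + b′) (+-monoʳ-≤ (ex P + ex P + P) (sup b′≤a′ a′≤P)) ⟩
    (ex P + ex P + P) + ex (a′ + b′) + (a′ + b′)
      ≡⟨ cong (λ y → y + ex (a′ + b′) + (a′ + b′)) (ex-size-suc q) ⟨
    ex (size (suc q)) + ex (a′ + b′) + (a′ + b′)
      ≡⟨ ex-top (suc q) s≤ ⟨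
    ex (size (suc q) + (a′ + b′))
      ≡⟨ cong ex (trans (cong (_+ (a′ + b′)) (size-suc q)) (regroup′ P a′ b′)) ⟩
    ex (P + a′ + (P + b′))
      ∎
    where
    open ≤-Reasoning
    b′≤P : b′ ≤ P
    b′≤P = ≤-trans b′≤a′ a′≤P
    s≤ : a′ + b′ ≤ size (suc q)
    s≤ = ≤-trans (+-mono-≤ a′≤P b′≤P) (≤-reflexive (sym (size-suc q)))
    regroup : ∀ e f a g b p → e + f + a + (e + g + b) + (p + b) ≡ (e + e + p) + (f + g + b) + (a + b)
    regroup = solve-∀
    regroup′ : ∀ p a b → p + p + (a + b) ≡ p + a + (p + b)
    regroup′ = solve-∀

  -- With u = P − b, v = P − a′ and a′ + b = P + Y we have u + v + Y = P, and ex-complement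
  -- reduces the claim to superadditivity for u and v.
  ex-superadditive-overflow : ∀ {a′ b} → a′ ≤ P → b ≤ P → P ≤ a′ + b →
                              ex (P + a′) + ex b + b ≤ ex (P + a′ + b)
  ex-superadditive-overflow {a′} {b} a′≤P b≤P P≤s = +-cancelʳ-≤ ((u + v) * S) _ _ (begin
    ex (P + a′) + ex b + b + (u + v) * S
      ≡⟨ cong (λ y → y + ex b + b + (u + v) * S) (ex-top q a′≤P) ⟩
    ex P + ex a′ + a′ + ex b + b + (u + v) * S
      ≡⟨ regroup (ex P) (ex a′) a′ (ex b) b u v S ⟩
    ex P + (ex a′ + v * S) + (ex b + u * S) + (a′ + b)
      ≡⟨ cong₂ (λ y z → ex P + y + z + (a′ + b)) (ex-complement q v v+a′≡) (ex-complement q u u+b≡) ⟩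
    ex P + (ex P + ex v) + (ex P + ex u) + (a′ + b)
      ≡⟨ cong (ex P + (ex P + ex v) + (ex P + ex u) +_) P+Y≡ ⟨
    ex P + (ex P + ex v) + (ex P + ex u) + (P + Y)
      ≡⟨ regroup′ (ex P) (ex v) (ex u) P Y ⟩
    (ex P + ex P + P) + (ex P + (ex u + ex v)) + Y
      ≤⟨ +-monoˡ-≤ Y (+-monoʳ-≤ (ex P + ex P + P) (+-monoʳ-≤ (ex P) (ex-+-≤ q sup u≤P v≤P))) ⟩
    (ex P + ex P + P) + (ex P + ex (u + v)) + Y
      ≡⟨ cong (λ y → (ex P + ex P + P) + y + Y) (ex-complement q (u + v) u+v+Y≡) ⟨
    (ex P + ex P + P) + (ex Y + (u + v) * S) + Y
      ≡⟨ regroup″ (ex P + ex P + P) (ex Y) ((u + v) * S) Y ⟩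
    (ex P + ex P + P) + ex Y + Y + (u + v) * S
      ≡⟨ cong (λ y → y + ex Y + Y + (u + v) * S) (ex-size-suc q) ⟨
    ex (size (suc q)) + ex Y + Y + (u + v) * S
      ≡⟨ cong (_+ (u + v) * S) (ex-top (suc q) Y≤) ⟨
    ex (size (suc q) + Y) + (u + v) * S
      ≡⟨ cong (λ y → ex y + (u + v) * S) total≡ ⟩
    ex (P + a′ + b) + (u + v) * S
      ∎)
    where
    open ≤-Reasoning
    S = 3 + q
    Y = a′ + b ∸ P
    u = P ∸ b
    v = P ∸ a′
    u≤P : u ≤ P
    u≤P = m∸n≤m P b
    v≤P : v ≤ P
    v≤P = m∸n≤m P a′
    P+Y≡ : P + Y ≡ a′ + b
    P+Y≡ = m+[n∸m]≡n P≤s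
    u+b≡ : u + b ≡ P
    u+b≡ = trans (+-comm u b) (m+[n∸m]≡n b≤P)
    v+a′≡ : v + a′ ≡ P
    v+a′≡ = trans (+-comm v a′) (m+[n∸m]≡n a′≤P)
    u+v+Y≡ : u + v + Y ≡ P
    u+v+Y≡ = complements-sum a′≤P b≤P P≤s
    Y≤ : Y ≤ size (suc q)
    Y≤ = ≤-trans (subst (Y ≤_) u+v+Y≡ (m≤n+m Y (u + v))) (size-mono (n≤1+n q))
    total≡ : size (suc q) + Y ≡ P + a′ + b
    total≡ = trans (cong (_+ Y) (size-suc q)) (trans (+-assoc P P Y) (trans (cong (P +_) P+Y≡) (sym (+-assoc P a′ b))))
    regroup : ∀ e f a g b u v s → e + f + a + g + b + (u + v) * s ≡ e + (f + v * s) + (g + u * s) + (a + b)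
    regroup = solve-∀
    regroup′ : ∀ e f g p y → e + (e + f) + (e + g) + (p + y) ≡ (e + e + p) + (e + (g + f)) + y
    regroup′ = solve-∀
    regroup″ : ∀ a b c d → a + (b + c) + d ≡ a + b + d + c
    regroup″ = solve-∀

ex-superadditive : ∀ q → SuperadditiveUpTo q
ex-superadditive zero = ex-superadditive-base
ex-superadditive (suc q) {a} {b} b≤a a≤ with halves q a≤
... | lower a≤P = ex-superadditive q b≤a a≤P
... | upper {a′} a′≤P with halves q (≤-trans b≤a a≤)
...   | upper {b′} b′≤P =
  ex-superadditive-upper-upper q (ex-superadditive q) (+-cancelˡ-≤ (size q) b′ a′ b≤a) a′≤P
...   | lower b≤P with a′ + b ≤? size q
...     | yes s≤P = ex-superadditive-upper-lower q (ex-superadditive q) a′≤P b≤P s≤P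
...     | no  s≰P = ex-superadditive-overflow q (ex-superadditive q) a′≤P b≤P (<⇒≤ (≰⇒> s≰P))

ex-superadditive-⊓ : ∀ q {a b} → a ≤ size q → b ≤ size q → ex a + ex b + a ⊓ b ≤ ex (a + b)
ex-superadditive-⊓ q {a} {b} a≤ b≤ with ≤-total b a
... | inj₁ b≤a = subst (λ y → ex a + ex b + y ≤ ex (a + b)) (sym (m≥n⇒m⊓n≡n b≤a)) (ex-superadditive q b≤a a≤)
... | inj₂ a≤b = begin
  ex a + ex b + a ⊓ b   ≡⟨ cong₂ _+_ (+-comm (ex a) (ex b)) (m≤n⇒m⊓n≡m a≤b) ⟩
  ex b + ex a + a       ≤⟨ ex-superadditive q a≤b b≤ ⟩
  ex (b + a)            ≡⟨ cong ex (+-comm b a) ⟩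
  ex (a + b)            ∎
  where open ≤-Reasoning

ex-linear : ∀ q {j} → j ≤ size q → 2 * ex j ≤ j * (3 + q)
ex-linear zero {0} _ = z≤n
ex-linear zero {1} _ = z≤n
ex-linear zero {2} _ = ≤ᵇ⇒≤ _ _ _
ex-linear zero {3} _ = ≤ᵇ⇒≤ _ _ _
ex-linear zero {4} _ = ≤ᵇ⇒≤ _ _ _
ex-linear zero {suc (suc (suc (suc (suc _))))} (s≤s (s≤s (s≤s (s≤s ()))))
ex-linear (suc q) j≤ with halves q j≤
... | lower {j} j≤P = ≤-trans (ex-linear q j≤P) (*-monoʳ-≤ j (n≤1+n (3 + q)))
... | upper {x} x≤P = begin
  2 * ex (P + x)                          ≡⟨ 2*ex-top q x≤P ⟩
  P * (3 + q) + 2 * ex x + (x + x)        ≤⟨ +-mono-≤ (+-monoʳ-≤ (P * (3 + q)) (ex-linear q x≤P)) (+-monoˡ-≤ x x≤P) ⟩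
  P * (3 + q) + x * (3 + q) + (P + x)     ≡⟨ regroup P x q ⟩
  (P + x) * (4 + q)                       ∎
  where
  open ≤-Reasoning
  P = size q
  regroup : ∀ p x q → p * (3 + q) + x * (3 + q) + (p + x) ≡ (p + x) * (4 + q)
  regroup = solve-∀

ceil3≤ : ∀ {x} → 1 ≤ x → ceil3 x ≤ x
ceil3≤ {x} 1≤x = begin
  (x + 2) / 3   ≤⟨ /-monoˡ-≤ 3 (≤-trans (+-monoʳ-≤ x (*-monoʳ-≤ 2 1≤x)) (≤-reflexive (x+2x≡x*3 x))) ⟩
  x * 3 / 3     ≡⟨ m*n/n≡m x 3 ⟩
  x             ∎
  where
  open ≤-Reasoning
  x+2x≡x*3 : ∀ x → x + 2 * x ≡ x * 3
  x+2x≡x*3 = solve-∀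

ceil3-2^-step : ∀ r → ceil3 (2 ^ (3 + r)) ≡ 2 ^ suc r + ceil3 (2 ^ suc r)
ceil3-2^-step r = begin
  (2 ^ (3 + r) + 2) / 3                      ≡⟨ cong (_/ 3) (regroup (2 ^ r)) ⟩
  (2 ^ suc r * 3 + (2 ^ suc r + 2)) / 3      ≡⟨ +-distrib-/-∣ˡ (2 ^ suc r + 2) (divides-refl (2 ^ suc r)) ⟩
  2 ^ suc r * 3 / 3 + (2 ^ suc r + 2) / 3    ≡⟨ cong (_+ ceil3 (2 ^ suc r)) (m*n/n≡m (2 ^ suc r) 3) ⟩
  2 ^ suc r + ceil3 (2 ^ suc r)              ∎
  where
  open ≡-Reasoning
  regroup : ∀ y → 2 * (2 * (2 * y)) + 2 ≡ 2 * y * 3 + (2 * y + 2)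
  regroup = solve-∀

ex-third-step : ∀ r → (∀ {x} → x ≤ ceil3 (2 ^ suc (suc r)) → 2 * ex x ≤ x * suc r) →
                ∀ {j} → j ≤ ceil3 (2 ^ (4 + r)) → 2 * ex j ≤ j * (3 + r)
ex-third-step r ih {j} j≤ with j ≤? size r
... | yes j≤P = ex-linear r j≤P
... | no  j≰P = begin
  2 * ex j                                ≡⟨ cong (λ y → 2 * ex y) j≡ ⟨
  2 * ex (P + x)                          ≡⟨ 2*ex-top r x≤P ⟩
  P * (3 + r) + 2 * ex x + (x + x)        ≤⟨ +-monoˡ-≤ (x + x) (+-monoʳ-≤ (P * (3 + r)) (ih x≤)) ⟩
  P * (3 + r) + x * suc r + (x + x)       ≡⟨ regroup P x r ⟩
  (P + x) * (3 + r)                       ≡⟨ cong (_* (3 + r)) j≡ ⟩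
  j * (3 + r)                             ∎
  where
  open ≤-Reasoning
  P = size r
  x = j ∸ P
  j≡ : P + x ≡ j
  j≡ = m+[n∸m]≡n (<⇒≤ (≰⇒> j≰P))
  x≤ : x ≤ ceil3 (2 ^ suc (suc r))
  x≤ = m≤n+o⇒m∸n≤o j P (subst (j ≤_) (ceil3-2^-step (suc r)) j≤)
  x≤P : x ≤ P
  x≤P = ≤-trans x≤ (ceil3≤ (m^n>0 2 (2 + r)))
  regroup : ∀ p x r → p * (3 + r) + x * (1 + r) + (x + x) ≡ (p + x) * (3 + r)
  regroup = solve-∀

ex-third : ∀ r {j} → j ≤ ceil3 (2 ^ suc r) → 2 * ex j ≤ j * r
ex-third 0 {0} _ = z≤n
ex-third 0 {1} _ = z≤n
ex-third 0 {suc (suc _)} (s≤s ())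
ex-third 1 {0} _ = z≤n
ex-third 1 {1} _ = z≤n
ex-third 1 {2} _ = ≤-refl
ex-third 1 {suc (suc (suc _))} (s≤s (s≤s ()))
ex-third 2 {0} _ = z≤n
ex-third 2 {1} _ = z≤n
ex-third 2 {2} _ = ≤ᵇ⇒≤ _ _ _
ex-third 2 {3} _ = ≤-refl
ex-third 2 {suc (suc (suc (suc _)))} (s≤s (s≤s (s≤s ())))
ex-third (suc (suc (suc r))) = ex-third-step r (ex-third (suc r))

-- (n+1)·2^k − (k+1)·2^k ≤ (n+1)m − 2 ex m for d = n + 1 and k = q + 2, with the subtractions moved across.
cut-comparison : ∀ q {m j r d} → m + j ≡ size q → 2 * ex j ≤ j * r → d + r ≡ 2 * (3 + q) →
                 d * size q + 2 * ex m ≤ d * m + (3 + q) * size q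
cut-comparison q {m} {j} {r} {d} m+j≡K 2ex≤jr d+r≡2S = +-cancelʳ-≤ (2 * (j * S)) _ _ (begin
  d * K + 2 * ex m + 2 * (j * S)     ≡⟨ regroup (d * K) (ex m) (j * S) ⟩
  d * K + 2 * (ex m + j * S)         ≡⟨ cong (λ y → d * K + 2 * y) (ex-complement q j (trans (+-comm j m) m+j≡K)) ⟩
  d * K + 2 * (ex K + ex j)          ≡⟨ regroup′ (d * K) (ex K) (ex j) ⟩
  d * K + 2 * ex K + 2 * ex j        ≡⟨ cong (λ y → d * K + y + 2 * ex j) (ex-size q) ⟩
  d * K + K * S + 2 * ex j           ≤⟨ +-monoʳ-≤ (d * K + K * S) 2ex≤jr ⟩
  d * K + K * S + j * r              ≡⟨ cong (λ y → d * y + K * S + j * r) m+j≡K ⟨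
  d * (m + j) + K * S + j * r        ≡⟨ regroup″ d m j (K * S) r ⟩
  d * m + K * S + j * (d + r)        ≡⟨ cong (λ y → d * m + K * S + j * y) d+r≡2S ⟩
  d * m + K * S + j * (2 * S)        ≡⟨ regroup‴ (d * m) K S j ⟩
  d * m + S * K + 2 * (j * S)        ∎)
  where
  open ≤-Reasoning
  K = size q
  S = 3 + q
  regroup : ∀ a e c → a + 2 * e + 2 * c ≡ a + 2 * (e + c)
  regroup = solve-∀
  regroup′ : ∀ a e f → a + 2 * (e + f) ≡ a + 2 * e + 2 * f
  regroup′ = solve-∀
  regroup″ : ∀ d m j c r → d * (m + j) + c + j * r ≡ d * m + c + j * (d + r)
  regroup″ = solve-∀
  regroup‴ : ∀ a k s j → a + k * s + j * (2 * s) ≡ a + s * k + 2 * (j * s)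
  regroup‴ = solve-∀

ex-superadditive-2^ : ∀ {n} → 2 ≤ n → ∀ {a b} → a ≤ 2 ^ n → b ≤ 2 ^ n → ex a + ex b + a ⊓ b ≤ ex (a + b)
ex-superadditive-2^ {suc (suc q)} (s≤s (s≤s z≤n)) = ex-superadditive-⊓ q

⟦_⟧ : Bool → ℕ
⟦ b ⟧ = if b then 1 else 0

∑-mono-≤ : ∀ {N} {f g : Fin N → ℕ} → (∀ i → f i ≤ g i) → ∑[ i < N ] f i ≤ ∑[ i < N ] g i
∑-mono-≤ {zero}  f≤g = z≤n
∑-mono-≤ {suc N} f≤g = +-mono-≤ (f≤g zero) (∑-mono-≤ (f≤g ∘ suc))

∑-const : ∀ N c → ∑[ i < N ] c ≡ N * c
∑-const zero    c = refl
∑-const (suc N) c = cong (c +_) (∑-const N c)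

∑-↑ : ∀ m n (f : Fin (m + n) → ℕ) → ∑[ x < m + n ] f x ≡ ∑[ i < m ] f (i ↑ˡ n) + ∑[ j < n ] f (m ↑ʳ j)
∑-↑ zero    n f = refl
∑-↑ (suc m) n f = trans (cong (f zero +_) (∑-↑ m n (f ∘ suc))) (sym (+-assoc (f zero) _ _))

∑∑-↑ : ∀ m n (f : Fin (m + n) → Fin (m + n) → ℕ) →
       ∑[ x < m + n ] ∑[ y < m + n ] f x y ≡
         (∑[ i < m ] ∑[ i′ < m ] f (i ↑ˡ n) (i′ ↑ˡ n) + ∑[ i < m ] ∑[ j < n ] f (i ↑ˡ n) (m ↑ʳ j))
       + (∑[ j < n ] ∑[ i < m ] f (m ↑ʳ j) (i ↑ˡ n) + ∑[ j < n ] ∑[ j′ < n ] f (m ↑ʳ j) (m ↑ʳ j′))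
∑∑-↑ m n f = trans (∑-↑ m n (λ x → ∑[ y < m + n ] f x y)) (cong₂ _+_
  (trans (sum-cong-≗ (λ i → ∑-↑ m n (f (i ↑ˡ n))))
         (∑-distrib-+ (λ i → ∑[ i′ < m ] f (i ↑ˡ n) (i′ ↑ˡ n)) (λ i → ∑[ j < n ] f (i ↑ˡ n) (m ↑ʳ j))))
  (trans (sum-cong-≗ (λ j → ∑-↑ m n (f (m ↑ʳ j))))
         (∑-distrib-+ (λ j → ∑[ i < m ] f (m ↑ʳ j) (i ↑ˡ n)) (λ j → ∑[ j′ < n ] f (m ↑ʳ j) (m ↑ʳ j′)))))

∑-≤-indicator : ∀ {N} {f e : Fin N → ℕ} c → (∀ i → f i ≤ c * e i) → ∑[ i < N ] e i ≡ 1 → ∑[ i < N ] f i ≤ c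
∑-≤-indicator {N} {f} {e} c f≤ ∑e≡1 = begin
  ∑[ i < N ] f i          ≤⟨ ∑-mono-≤ f≤ ⟩
  ∑[ i < N ] (c * e i)    ≡⟨ *-distribˡ-sum c e ⟨
  c * ∑[ i < N ] e i      ≡⟨ cong (c *_) ∑e≡1 ⟩
  c * 1                   ≡⟨ *-identityʳ c ⟩
  c                       ∎
  where open ≤-Reasoning

⌊suc≟suc⌋ : ∀ {N} (a b : Fin N) → ⌊ suc a ≟ suc b ⌋ ≡ ⌊ a ≟ b ⌋
⌊suc≟suc⌋ a b with a ≟ b
... | yes _ = refl
... | no  _ = refl

∑-≟ˡ : ∀ {N} (a : Fin N) → ∑[ j < N ] ⟦ ⌊ a ≟ j ⌋ ⟧ ≡ 1
∑-≟ˡ {suc N} zero    = cong suc (trans (∑-const N 0) (*-zeroʳ N))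
∑-≟ˡ {suc N} (suc a) = trans (sum-cong-≗ (cong ⟦_⟧ ∘ ⌊suc≟suc⌋ a)) (∑-≟ˡ a)

∑-≟ʳ : ∀ {N} (a : Fin N) → ∑[ j < N ] ⟦ ⌊ j ≟ a ⌋ ⟧ ≡ 1
∑-≟ʳ {suc N} zero    = cong suc (trans (∑-const N 0) (*-zeroʳ N))
∑-≟ʳ {suc N} (suc a) = trans (sum-cong-≗ (λ j → cong ⟦_⟧ (⌊suc≟suc⌋ j a))) (∑-≟ʳ a)

module _ {N : ℕ} where

  full : Fin N → Bool
  full _ = true

  count : (Fin N → Bool) → ℕ
  count p = ∑[ u < N ] ⟦ p u ⟧

  degree : Graph N → Fin N → ℕ
  degree G u = ∑[ v < N ] ⟦ G u v ⟧

  degreeIn : Graph N → (Fin N → Bool) → Fin N → ℕ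
  degreeIn G p u = ∑[ v < N ] ⟦ p v ∧ G u v ⟧

  Regular : Graph N → ℕ → Set
  Regular G d = ∀ u → degree G u ≡ d

  MinDegree≥ : Graph N → (Fin N → Bool) → ℕ → Set
  MinDegree≥ G p c = ∀ u → T (p u) → c ≤ degreeIn G p u

  -- Ordered pairs, i.e. twice the number of edges of G[p] when G is symmetric.
  inner : Graph N → (Fin N → Bool) → ℕ
  inner G p = ∑[ u < N ] ∑[ v < N ] ⟦ p u ∧ p v ∧ G u v ⟧

  cut : Graph N → (Fin N → Bool) → ℕ
  cut G p = ∑[ u < N ] ∑[ v < N ] ⟦ p u ∧ not (p v) ∧ G u v ⟧

  count-full : count full ≡ N
  count-full = trans (∑-const N 1) (*-identityʳ N)

  count≤ : ∀ p → count p ≤ N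
  count≤ p = ≤-trans (∑-mono-≤ (⟦⟧≤1 ∘ p)) (≤-reflexive (trans (∑-const N 1) (*-identityʳ N)))
    where
    ⟦⟧≤1 : ∀ b → ⟦ b ⟧ ≤ 1
    ⟦⟧≤1 true  = ≤-refl
    ⟦⟧≤1 false = z≤n

  inner+cut≡ : ∀ {G d} → Regular G d → ∀ p → inner G p + cut G p ≡ d * count p
  inner+cut≡ {G} {d} reg p = begin
    inner G p + cut G p
      ≡⟨ ∑-distrib-+ (λ u → ∑[ v < N ] inside u v) (λ u → ∑[ v < N ] crossing u v) ⟨
    ∑[ u < N ] (∑[ v < N ] inside u v + ∑[ v < N ] crossing u v)
      ≡⟨ sum-cong-≗ (λ u → trans (sym (∑-distrib-+ (inside u) (crossing u))) (sum-cong-≗ (split u))) ⟩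
    ∑[ u < N ] ∑[ v < N ] (⟦ p u ⟧ * ⟦ G u v ⟧)
      ≡⟨ sum-cong-≗ (λ u → trans (sym (*-distribˡ-sum ⟦ p u ⟧ (λ v → ⟦ G u v ⟧))) (cong (⟦ p u ⟧ *_) (reg u))) ⟩
    ∑[ u < N ] (⟦ p u ⟧ * d)
      ≡⟨ sum-cong-≗ (λ u → *-comm ⟦ p u ⟧ d) ⟩
    ∑[ u < N ] (d * ⟦ p u ⟧)
      ≡⟨ *-distribˡ-sum d (λ u → ⟦ p u ⟧) ⟨
    d * count p
      ∎
    where
    open ≡-Reasoning
    inside crossing : Fin N → Fin N → ℕ
    inside u v = ⟦ p u ∧ p v ∧ G u v ⟧
    crossing u v = ⟦ p u ∧ not (p v) ∧ G u v ⟧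
    split : ∀ u v → inside u v + crossing u v ≡ ⟦ p u ⟧ * ⟦ G u v ⟧
    split u v with p u | p v | G u v
    ... | true  | true  | true  = refl
    ... | true  | true  | false = refl
    ... | true  | false | true  = refl
    ... | true  | false | false = refl
    ... | false | _     | _     = refl

  *count≤inner : ∀ {G p c} → MinDegree≥ G p c → c * count p ≤ inner G p
  *count≤inner {G} {p} {c} deg≥ = begin
    c * count p                                ≡⟨ *-distribˡ-sum c (λ u → ⟦ p u ⟧) ⟩
    ∑[ u < N ] (c * ⟦ p u ⟧)                   ≤⟨ ∑-mono-≤ pointwise ⟩
    inner G p                                  ∎
    where
    open ≤-Reasoning
    pointwise : ∀ u → c * ⟦ p u ⟧ ≤ ∑[ v < N ] ⟦ p u ∧ p v ∧ G u v ⟧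
    pointwise u with p u | deg≥ u
    ... | true  | deg≥u = ≤-trans (≤-reflexive (*-identityʳ c)) (deg≥u tt)
    ... | false | _     = ≤-trans (≤-reflexive (*-zeroʳ c)) z≤n

data Walk {N} (G : Graph N) (p : Fin N → Bool) : Fin N → Fin N → Set where
  here : ∀ {u} → Walk G p u u
  next : ∀ {u v w} → T (G u v) → T (p v) → Walk G p v w → Walk G p u w

Connected : ∀ {N} → Graph N → (Fin N → Bool) → Set
Connected G p = ∀ u w → T (p u) → T (p w) → Walk G p u w

_++ʷ_ : ∀ {N} {G : Graph N} {p u v w} → Walk G p u v → Walk G p v w → Walk G p u w
here         ++ʷ r = r
next e pv w₁ ++ʷ r = next e pv (w₁ ++ʷ r)

edge : ∀ {N} {G : Graph N} {p u v} → T (G u v) → T (p v) → Walk G p u v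
edge e pv = next e pv here

walk-map : ∀ {M N} {G : Graph M} {G′ : Graph N} {p p′} (f : Fin M → Fin N) →
           (∀ {u v} → T (G u v) → T (G′ (f u) (f v))) → (∀ {v} → T (p v) → T (p′ (f v))) →
           ∀ {u w} → Walk G p u w → Walk G′ p′ (f u) (f w)
walk-map f fe fp here           = here
walk-map f fe fp (next e pv w₁) = next (fe e) (fp pv) (walk-map f fe fp w₁)

walk-weaken : ∀ {N} {G : Graph N} {p p′} → (∀ {v} → T (p v) → T (p′ v)) → ∀ {u w} → Walk G p u w → Walk G p′ u w
walk-weaken = walk-map (λ v → v) (λ e → e)

connected-≗ : ∀ {N} {G : Graph N} {p p′} → (∀ u → p u ≡ p′ u) → Connected G p → Connected G p′
connected-≗ p≗p′ conn u w p′u p′w =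
  walk-weaken (subst T (p≗p′ _)) (conn u w (subst T (sym (p≗p′ u)) p′u) (subst T (sym (p≗p′ w)) p′w))

module _ {M N} (π : Permutation M N) (H : Graph M) (G : Graph N) (iso : IsoVia π H G) where
  private
    π⁺ = π ⟨$⟩ʳ_
    π⁻ = π ⟨$⟩ˡ_

  regular-iso : ∀ {d} → Regular H d → Regular G d
  regular-iso {d} reg w = begin
    degree G w                         ≡⟨ cong (degree G) (inverseʳ π) ⟨
    degree G (π⁺ (π⁻ w))               ≡⟨ ∑-permute (λ v → ⟦ G (π⁺ (π⁻ w)) v ⟧) π ⟩
    ∑[ v < M ] ⟦ G (π⁺ (π⁻ w)) (π⁺ v) ⟧ ≡⟨ sum-cong-≗ (λ v → cong ⟦_⟧ (iso (π⁻ w) v)) ⟩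
    degree H (π⁻ w)                    ≡⟨ reg (π⁻ w) ⟩
    d                                  ∎
    where open ≡-Reasoning

  count-iso : ∀ p → count p ≡ count (p ∘ π⁺)
  count-iso p = ∑-permute (λ v → ⟦ p v ⟧) π

  inner-iso : ∀ p → inner G p ≡ inner H (p ∘ π⁺)
  inner-iso p =
    trans (∑-permute (λ x → ∑[ y < N ] ⟦ p x ∧ p y ∧ G x y ⟧) π) (sum-cong-≗ λ u →
    trans (∑-permute (λ y → ⟦ p (π⁺ u) ∧ p y ∧ G (π⁺ u) y ⟧) π) (sum-cong-≗ λ v →
    cong (λ e → ⟦ p (π⁺ u) ∧ p (π⁺ v) ∧ e ⟧) (iso u v)))

  inner-bound-iso : ∀ (f : ℕ → ℕ) → (∀ q → inner H q ≤ f (count q)) → ∀ p → inner G p ≤ f (count p)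
  inner-bound-iso f bound p = subst₂ (λ x c → x ≤ f c) (sym (inner-iso p)) (sym (count-iso p)) (bound (p ∘ π⁺))

  count-iso⁻ : ∀ q → count (q ∘ π⁻) ≡ count q
  count-iso⁻ q = trans (count-iso (q ∘ π⁻)) (sum-cong-≗ λ u → cong (λ y → ⟦ q y ⟧) (inverseˡ π {u}))

  minDegree-iso⁻ : ∀ {q c} → MinDegree≥ H q c → MinDegree≥ G (q ∘ π⁻) c
  minDegree-iso⁻ {q} {c} deg≥ u qu = begin
    c                                      ≤⟨ deg≥ (π⁻ u) qu ⟩
    degreeIn H q (π⁻ u)                    ≡⟨ sum-cong-≗ (λ v → cong₂ (λ y e → ⟦ q y ∧ e ⟧) (inverseˡ π) (iso (π⁻ u) v)) ⟨
    ∑[ v < M ] ⟦ q (π⁻ (π⁺ v)) ∧ G (π⁺ (π⁻ u)) (π⁺ v) ⟧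
                                           ≡⟨ ∑-permute (λ y → ⟦ q (π⁻ y) ∧ G (π⁺ (π⁻ u)) y ⟧) π ⟨
    degreeIn G (q ∘ π⁻) (π⁺ (π⁻ u))        ≡⟨ cong (degreeIn G (q ∘ π⁻)) (inverseʳ π) ⟩
    degreeIn G (q ∘ π⁻) u                  ∎
    where open ≤-Reasoning

  connected-iso⁻ : ∀ {q} → Connected H q → Connected G (q ∘ π⁻)
  connected-iso⁻ {q} conn u w qu qw =
    subst₂ (Walk G (q ∘ π⁻)) (inverseʳ π) (inverseʳ π)
      (walk-map π⁺ (λ {x} {y} e → subst T (sym (iso x y)) e) (subst T (cong q (sym (inverseˡ π))))
        (conn (π⁻ u) (π⁻ w) qu qw))

-- The two halves of joinMatch

elim-↑ : ∀ {k} (P : Fin (k + k) → Set) → (∀ i → P (i ↑ˡ k)) → (∀ j → P (k ↑ʳ j)) → ∀ x → P x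
elim-↑ {k} P left right x = subst P (join-splitAt k k x) (on (splitAt k x))
  where
  on : ∀ s → P (join k k s)
  on (inj₁ i) = left i
  on (inj₂ j) = right j

sideˡ : ∀ k → (Fin k → Bool) → Fin (k + k) → Bool
sideˡ k b x = [ b , (λ _ → false) ]′ (splitAt k x)

module _ {k : ℕ} where

  sideˡ-↑ˡ : ∀ b i → sideˡ k b (i ↑ˡ k) ≡ b i
  sideˡ-↑ˡ b i = cong [ b , (λ _ → false) ]′ (splitAt-↑ˡ k i k)

  sideˡ-↑ʳ : ∀ b j → sideˡ k b (k ↑ʳ j) ≡ false
  sideˡ-↑ʳ b j = cong [ b , (λ _ → false) ]′ (splitAt-↑ʳ k k j)

  ¬sideˡ-↑ʳ : ∀ b j → T (sideˡ k b (k ↑ʳ j)) → ⊥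
  ¬sideˡ-↑ʳ b j bj with () ← subst T (sideˡ-↑ʳ b j) bj

  count-sideˡ : ∀ b → count (sideˡ k b) ≡ count b
  count-sideˡ b = begin
    count (sideˡ k b)                                                   ≡⟨ ∑-↑ k k (λ x → ⟦ sideˡ k b x ⟧) ⟩
    ∑[ i < k ] ⟦ sideˡ k b (i ↑ˡ k) ⟧ + ∑[ j < k ] ⟦ sideˡ k b (k ↑ʳ j) ⟧
      ≡⟨ cong₂ _+_ (sum-cong-≗ (cong ⟦_⟧ ∘ sideˡ-↑ˡ b)) (sum-cong-≗ (cong ⟦_⟧ ∘ sideˡ-↑ʳ b)) ⟩
    count b + ∑[ j < k ] 0                                              ≡⟨ cong (count b +_) (trans (∑-const k 0) (*-zeroʳ k)) ⟩
    count b + 0                                                         ≡⟨ +-identityʳ (count b) ⟩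
    count b                                                             ∎
    where open ≡-Reasoning

module JoinMatch {k} (G0 G1 : Graph k) (σ : Permutation′ k) where

  J : Graph (k + k)
  J = joinMatch G0 G1 σ

  matches : Fin k → Fin k → Bool
  matches i j = ⌊ σ ⟨$⟩ʳ i ≟ j ⌋

  J-ˡˡ : ∀ i j → J (i ↑ˡ k) (j ↑ˡ k) ≡ G0 i j
  J-ˡˡ i j rewrite splitAt-↑ˡ k i k | splitAt-↑ˡ k j k = refl

  J-ʳʳ : ∀ i j → J (k ↑ʳ i) (k ↑ʳ j) ≡ G1 i j
  J-ʳʳ i j rewrite splitAt-↑ʳ k k i | splitAt-↑ʳ k k j = refl

  J-ˡʳ : ∀ i j → J (i ↑ˡ k) (k ↑ʳ j) ≡ matches i j
  J-ˡʳ i j rewrite splitAt-↑ˡ k i k | splitAt-↑ʳ k k j = refl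

  J-ʳˡ : ∀ j i → J (k ↑ʳ j) (i ↑ˡ k) ≡ matches i j
  J-ʳˡ j i rewrite splitAt-↑ʳ k k j | splitAt-↑ˡ k i k = refl

  ∑-matchesʳ : ∀ i → ∑[ j < k ] ⟦ matches i j ⟧ ≡ 1
  ∑-matchesʳ i = ∑-≟ˡ (σ ⟨$⟩ʳ i)

  ∑-matchesˡ : ∀ j → ∑[ i < k ] ⟦ matches i j ⟧ ≡ 1
  ∑-matchesˡ j = trans (sym (∑-permute (λ x → ⟦ ⌊ x ≟ j ⌋ ⟧) σ)) (∑-≟ʳ j)

  regular-joinMatch : ∀ {d} → Regular G0 d → Regular G1 d → Regular J (suc d)
  regular-joinMatch {d} reg0 reg1 = elim-↑ (λ x → degree J x ≡ suc d) left right
    where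
    left : ∀ i → degree J (i ↑ˡ k) ≡ suc d
    left i = trans (∑-↑ k k (λ y → ⟦ J (i ↑ˡ k) y ⟧)) (trans (cong₂ _+_
      (trans (sum-cong-≗ (cong ⟦_⟧ ∘ J-ˡˡ i)) (reg0 i))
      (trans (sum-cong-≗ (cong ⟦_⟧ ∘ J-ˡʳ i)) (∑-matchesʳ i))) (+-comm d 1))
    right : ∀ j → degree J (k ↑ʳ j) ≡ suc d
    right j = trans (∑-↑ k k (λ y → ⟦ J (k ↑ʳ j) y ⟧)) (cong₂ _+_
      (trans (sum-cong-≗ (cong ⟦_⟧ ∘ J-ʳˡ j)) (∑-matchesˡ j))
      (trans (sum-cong-≗ (cong ⟦_⟧ ∘ J-ʳʳ j)) (reg1 j)))

  matched : (Fin k → Bool) → (Fin k → Bool) → ℕ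
  matched a b = ∑[ i < k ] ∑[ j < k ] ⟦ a i ∧ b j ∧ matches i j ⟧

  matched≤ˡ : ∀ a b → matched a b ≤ count a
  matched≤ˡ a b = ∑-mono-≤ λ i → ∑-≤-indicator ⟦ a i ⟧ (λ j → bound (a i) (b j) (matches i j)) (∑-matchesʳ i)
    where
    bound : ∀ x y e → ⟦ x ∧ y ∧ e ⟧ ≤ ⟦ x ⟧ * ⟦ e ⟧
    bound true  true  true  = ≤-refl
    bound true  true  false = ≤-refl
    bound true  false e     = z≤n
    bound false y     e     = z≤n

  matched≤ʳ : ∀ a b → matched a b ≤ count b
  matched≤ʳ a b = ≤-trans (≤-reflexive (∑-comm (λ i j → ⟦ a i ∧ b j ∧ matches i j ⟧)))
    (∑-mono-≤ λ j → ∑-≤-indicator ⟦ b j ⟧ (λ i → bound (a i) (b j) (matches i j)) (∑-matchesˡ j))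
    where
    bound : ∀ x y e → ⟦ x ∧ y ∧ e ⟧ ≤ ⟦ y ⟧ * ⟦ e ⟧
    bound true  true  true  = ≤-refl
    bound true  true  false = z≤n
    bound true  false e     = z≤n
    bound false y     e     = z≤n

  inner-joinMatch : ∀ q → let q₀ = q ∘ (_↑ˡ k); q₁ = q ∘ (k ↑ʳ_) in
                    inner J q ≡ inner G0 q₀ + inner G1 q₁ + 2 * matched q₀ q₁
  inner-joinMatch q = begin
    inner J q                                                      ≡⟨ blocks ⟩
    (inner G0 q₀ + matched q₀ q₁) + (matched q₀ q₁ + inner G1 q₁)  ≡⟨ regroup (inner G0 q₀) (matched q₀ q₁) (inner G1 q₁) ⟩
    inner G0 q₀ + inner G1 q₁ + 2 * matched q₀ q₁                  ∎
    where
    open ≡-Reasoning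
    q₀ = q ∘ (_↑ˡ k)
    q₁ = q ∘ (k ↑ʳ_)
    entries : ∀ (a b : Fin k → Bool) {f g : Fin k → Fin k → Bool} → (∀ i j → f i j ≡ g i j) →
              ∑[ i < k ] ∑[ j < k ] ⟦ a i ∧ b j ∧ f i j ⟧ ≡ ∑[ i < k ] ∑[ j < k ] ⟦ a i ∧ b j ∧ g i j ⟧
    entries a b f≡g = sum-cong-≗ λ i → sum-cong-≗ λ j → cong (λ e → ⟦ a i ∧ b j ∧ e ⟧) (f≡g i j)
    ∧-swap : ∀ x y e → (x ∧ y ∧ e) ≡ (y ∧ x ∧ e)
    ∧-swap true  true  e = refl
    ∧-swap true  false e = refl
    ∧-swap false true  e = refl
    ∧-swap false false e = refl
    transposed : ∑[ j < k ] ∑[ i < k ] ⟦ q₁ j ∧ q₀ i ∧ matches i j ⟧ ≡ matched q₀ q₁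
    transposed = trans (sum-cong-≗ λ j → sum-cong-≗ λ i → cong ⟦_⟧ (∧-swap (q₁ j) (q₀ i) (matches i j)))
                       (sym (∑-comm (λ i j → ⟦ q₀ i ∧ q₁ j ∧ matches i j ⟧)))
    blocks : inner J q ≡ (inner G0 q₀ + matched q₀ q₁) + (matched q₀ q₁ + inner G1 q₁)
    blocks = trans (∑∑-↑ k k (λ x y → ⟦ q x ∧ q y ∧ J x y ⟧))
      (cong₂ _+_ (cong₂ _+_ (entries q₀ q₀ J-ˡˡ) (entries q₀ q₁ J-ˡʳ))
                 (cong₂ _+_ (trans (entries q₁ q₀ J-ʳˡ) transposed) (entries q₁ q₁ J-ʳʳ)))
    regroup : ∀ a m b → (a + m) + (m + b) ≡ a + b + 2 * m
    regroup = solve-∀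

  minDegree-sideˡ : ∀ {b c} → MinDegree≥ G0 b c → MinDegree≥ J (sideˡ k b) c
  minDegree-sideˡ {b} {c} deg≥ = elim-↑ (λ x → T (sideˡ k b x) → c ≤ degreeIn J (sideˡ k b) x) left right
    where
    left : ∀ i → T (sideˡ k b (i ↑ˡ k)) → c ≤ degreeIn J (sideˡ k b) (i ↑ˡ k)
    left i bi = begin
      c
        ≤⟨ deg≥ i (subst T (sideˡ-↑ˡ b i) bi) ⟩
      degreeIn G0 b i
        ≡⟨ sum-cong-≗ (λ j → cong₂ (λ y e → ⟦ y ∧ e ⟧) (sideˡ-↑ˡ b j) (J-ˡˡ i j)) ⟨
      ∑[ j < k ] ⟦ sideˡ k b (j ↑ˡ k) ∧ J (i ↑ˡ k) (j ↑ˡ k) ⟧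
        ≤⟨ m≤m+n _ _ ⟩
      ∑[ j < k ] ⟦ sideˡ k b (j ↑ˡ k) ∧ J (i ↑ˡ k) (j ↑ˡ k) ⟧ + ∑[ j < k ] ⟦ sideˡ k b (k ↑ʳ j) ∧ J (i ↑ˡ k) (k ↑ʳ j) ⟧
        ≡⟨ ∑-↑ k k (λ y → ⟦ sideˡ k b y ∧ J (i ↑ˡ k) y ⟧) ⟨
      degreeIn J (sideˡ k b) (i ↑ˡ k)
        ∎
      where open ≤-Reasoning
    right : ∀ j → T (sideˡ k b (k ↑ʳ j)) → c ≤ degreeIn J (sideˡ k b) (k ↑ʳ j)
    right j bj = ⊥-elim (¬sideˡ-↑ʳ b j bj)

  walkˡ : ∀ {p₀ p} → (∀ {i} → T (p₀ i) → T (p (i ↑ˡ k))) → ∀ {i j} → Walk G0 p₀ i j → Walk J p (i ↑ˡ k) (j ↑ˡ k)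
  walkˡ = walk-map (_↑ˡ k) (λ {i} {j} e → subst T (sym (J-ˡˡ i j)) e)

  walkʳ : ∀ {p₁ p} → (∀ {j} → T (p₁ j) → T (p (k ↑ʳ j))) → ∀ {i j} → Walk G1 p₁ i j → Walk J p (k ↑ʳ i) (k ↑ʳ j)
  walkʳ = walk-map (k ↑ʳ_) (λ {i} {j} e → subst T (sym (J-ʳʳ i j)) e)

  T-matches : ∀ i → T (matches i (σ ⟨$⟩ʳ i))
  T-matches i = fromWitness refl

  matchˡʳ : ∀ i → T (J (i ↑ˡ k) (k ↑ʳ (σ ⟨$⟩ʳ i)))
  matchˡʳ i = subst T (sym (J-ˡʳ i (σ ⟨$⟩ʳ i))) (T-matches i)

  matchʳˡ : ∀ i → T (J (k ↑ʳ (σ ⟨$⟩ʳ i)) (i ↑ˡ k))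
  matchʳˡ i = subst T (sym (J-ʳˡ (σ ⟨$⟩ʳ i) i)) (T-matches i)

  connected-sideˡ : ∀ {b} → Connected G0 b → Connected J (sideˡ k b)
  connected-sideˡ {b} conn = elim-↑ (λ x → ∀ y → T (sideˡ k b x) → T (sideˡ k b y) → Walk J (sideˡ k b) x y)
    (λ i → elim-↑ (λ y → T (sideˡ k b (i ↑ˡ k)) → T (sideˡ k b y) → Walk J (sideˡ k b) (i ↑ˡ k) y)
      (λ j bi bj → walkˡ (λ {i′} → subst T (sym (sideˡ-↑ˡ b i′))) (conn i j (inside i bi) (inside j bj)))
      (λ j _ bj → ⊥-elim (¬sideˡ-↑ʳ b j bj)))
    (λ j _ bj _ → ⊥-elim (¬sideˡ-↑ʳ b j bj))
    where
    inside : ∀ i → T (sideˡ k b (i ↑ˡ k)) → T (b i)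
    inside i = subst T (sideˡ-↑ˡ b i)

  -- Every vertex outside sideˡ k b reaches the right half, which lies entirely outside and is connected.
  connected-∁sideˡ : Connected G1 full → ∀ b → Connected J (not ∘ sideˡ k b)
  connected-∁sideˡ conn₁ b x y cx cy = through-right (toRight x cx) (fromRight y cy)
    where
    c = not ∘ sideˡ k b
    right-outside : ∀ {j} → T (c (k ↑ʳ j))
    right-outside {j} = subst T (cong not (sym (sideˡ-↑ʳ b j))) tt
    toRight : ∀ x → T (c x) → Σ (Fin k) λ j → Walk J c x (k ↑ʳ j)
    toRight = elim-↑ _ (λ i _ → σ ⟨$⟩ʳ i , edge (matchˡʳ i) right-outside) (λ j _ → j , here)
    fromRight : ∀ y → T (c y) → Σ (Fin k) λ j → Walk J c (k ↑ʳ j) y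
    fromRight = elim-↑ _ (λ i ci → σ ⟨$⟩ʳ i , edge (matchʳˡ i) ci) (λ j _ → j , here)
    through-right : Σ (Fin k) (λ j → Walk J c x (k ↑ʳ j)) → Σ (Fin k) (λ j → Walk J c (k ↑ʳ j) y) → Walk J c x y
    through-right (j , w₁) (j′ , w₂) = w₁ ++ʷ (walkʳ (λ _ → right-outside) (conn₁ j j′ tt tt) ++ʷ w₂)

  connected-joinMatch : Connected G1 full → Connected J full
  connected-joinMatch conn₁ x y _ _ =
    walk-weaken (λ _ → tt) (connected-∁sideˡ conn₁ (λ _ → false) x y (outside x) (outside y))
    where
    outside : ∀ x → T (not (sideˡ k (λ _ → false) x))
    outside x with splitAt k x
    ... | inj₁ _ = tt
    ... | inj₂ _ = tt

  inner-joinMatch-≤ : (∀ p → inner G0 p ≤ 2 * ex (count p)) → (∀ p → inner G1 p ≤ 2 * ex (count p)) →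
                      (∀ {a b} → a ≤ k → b ≤ k → ex a + ex b + a ⊓ b ≤ ex (a + b)) →
                      ∀ q → inner J q ≤ 2 * ex (count q)
  inner-joinMatch-≤ bound₀ bound₁ superadditive q = begin
    inner J q                                      ≡⟨ inner-joinMatch q ⟩
    inner G0 q₀ + inner G1 q₁ + 2 * matched q₀ q₁  ≤⟨ +-mono-≤ (+-mono-≤ (bound₀ q₀) (bound₁ q₁))
                                                               (*-monoʳ-≤ 2 (⊓-glb (matched≤ˡ q₀ q₁) (matched≤ʳ q₀ q₁))) ⟩
    2 * ex c₀ + 2 * ex c₁ + 2 * (c₀ ⊓ c₁)          ≡⟨ distrib (ex c₀) (ex c₁) (c₀ ⊓ c₁) ⟩
    2 * (ex c₀ + ex c₁ + c₀ ⊓ c₁)                  ≤⟨ *-monoʳ-≤ 2 (superadditive (count≤ q₀) (count≤ q₁)) ⟩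
    2 * ex (c₀ + c₁)                               ≡⟨ cong (λ c → 2 * ex c) (∑-↑ k k (λ x → ⟦ q x ⟧)) ⟨
    2 * ex (count q)                               ∎
    where
    open ≤-Reasoning
    q₀ = q ∘ (_↑ˡ k)
    q₁ = q ∘ (k ↑ʳ_)
    c₀ = count q₀
    c₁ = count q₁
    distrib : ∀ x y z → 2 * x + 2 * y + 2 * z ≡ 2 * (x + y + z)
    distrib = solve-∀

-- The family ℋ_n^4

K4-regular : Regular K4 3
K4-regular zero                   = refl
K4-regular (suc zero)             = refl
K4-regular (suc (suc zero))       = refl
K4-regular (suc (suc (suc zero))) = refl

K4-connected : Connected K4 full
K4-connected u w _ _ with u ≟ w
... | yes refl = here
... | no  u≢w = edge (fromWitnessFalse u≢w) tt

K4-inner≤ : ∀ p → inner K4 p ≤ 2 * ex (count p)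
K4-inner≤ p = check (p zero) (p (suc zero)) (p (suc (suc zero))) (p (suc (suc (suc zero))))
  where
  check : ∀ a b c d → let q = lookup (a ∷ b ∷ c ∷ d ∷ []) in inner K4 q ≤ 2 * ex (count q)
  check false false false false = ≤ᵇ⇒≤ _ _ _
  check false false false true  = ≤ᵇ⇒≤ _ _ _
  check false false true  false = ≤ᵇ⇒≤ _ _ _
  check false false true  true  = ≤ᵇ⇒≤ _ _ _
  check false true  false false = ≤ᵇ⇒≤ _ _ _
  check false true  false true  = ≤ᵇ⇒≤ _ _ _
  check false true  true  false = ≤ᵇ⇒≤ _ _ _
  check false true  true  true  = ≤ᵇ⇒≤ _ _ _
  check true  false false false = ≤ᵇ⇒≤ _ _ _
  check true  false false true  = ≤ᵇ⇒≤ _ _ _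
  check true  false true  false = ≤ᵇ⇒≤ _ _ _
  check true  false true  true  = ≤ᵇ⇒≤ _ _ _
  check true  true  false false = ≤ᵇ⇒≤ _ _ _
  check true  true  false true  = ≤ᵇ⇒≤ _ _ _
  check true  true  true  false = ≤ᵇ⇒≤ _ _ _
  check true  true  true  true  = ≤ᵇ⇒≤ _ _ _

InH4⇒2≤n : ∀ {n H} → InH4 n H → 2 ≤ n
InH4⇒2≤n (base _ _ _)             = ≤-refl
InH4⇒2≤n (step _ _ h₀ _ _ _ _ _) = ≤-trans (InH4⇒2≤n h₀) (n≤1+n _)

regular : ∀ {n H} → InH4 n H → Regular H (suc n)
regular (base G π iso)                 = regular-iso π K4 G iso K4-regular
regular (step G0 G1 h₀ h₁ σ G π iso) =
  regular-iso π _ G iso (JoinMatch.regular-joinMatch G0 G1 σ (regular h₀) (regular h₁))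

connected : ∀ {n H} → InH4 n H → Connected H full
connected (base G π iso)                = connected-iso⁻ π K4 G iso K4-connected
connected (step G0 G1 _ h₁ σ G π iso) =
  connected-iso⁻ π _ G iso (JoinMatch.connected-joinMatch G0 G1 σ (connected h₁))

inner≤2ex : ∀ {n H} → InH4 n H → ∀ p → inner H p ≤ 2 * ex (count p)
inner≤2ex (base G π iso) = inner-bound-iso π K4 G iso (λ c → 2 * ex c) K4-inner≤
inner≤2ex (step G0 G1 h₀ h₁ σ G π iso) = inner-bound-iso π _ G iso (λ c → 2 * ex c)
  (JoinMatch.inner-joinMatch-≤ G0 G1 σ (inner≤2ex h₀) (inner≤2ex h₁) (ex-superadditive-2^ (InH4⇒2≤n h₀)))

-- A copy of a member of ℋ_k^4: follow the G0 halves down to level k.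
block : ∀ {n H} → InH4 n H → ℕ → Fin (2 ^ n) → Bool
block (base _ _ _) k = full
block {suc n} (step _ _ h₀ _ _ _ π _) k with suc n ≤? k
... | yes _ = full
... | no  _ = sideˡ (2 ^ n) (block h₀ k) ∘ (π ⟨$⟩ˡ_)

count-block : ∀ {n H} (h : InH4 n H) {k} → 2 ≤ k → k ≤ n → count (block h k) ≡ 2 ^ k
count-block (base _ _ _) 2≤k k≤2 rewrite ≤-antisym k≤2 2≤k = refl
count-block {suc n} (step G0 _ h₀ _ _ G π iso) {k} 2≤k k≤ with suc n ≤? k
... | yes n<k = trans count-full (cong (2 ^_) (≤-antisym n<k k≤))
... | no  n≮k =
  trans (count-iso⁻ π _ G iso _) (trans (count-sideˡ (block h₀ k)) (count-block h₀ 2≤k (≤-pred (≰⇒> n≮k))))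

minDegree-block : ∀ {n H} (h : InH4 n H) {k} → k ≤ n → MinDegree≥ H (block h k) (suc k)
minDegree-block h@(base _ _ _) k≤2 u _ = ≤-trans (s≤s k≤2) (≤-reflexive (sym (regular h u)))
minDegree-block {suc n} h@(step G0 G1 h₀ _ σ G π iso) {k} k≤ with suc n ≤? k
... | yes _   = λ u _ → ≤-trans (s≤s k≤) (≤-reflexive (sym (regular h u)))
... | no  n≮k =
  minDegree-iso⁻ π _ G iso (JoinMatch.minDegree-sideˡ G0 G1 σ (minDegree-block h₀ (≤-pred (≰⇒> n≮k))))

connected-block : ∀ {n H} (h : InH4 n H) k → Connected H (block h k)
connected-block h@(base _ _ _) k = connected h
connected-block {suc n} h@(step G0 G1 h₀ _ σ G π iso) k with suc n ≤? k
... | yes _ = connected h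
... | no  _ = connected-iso⁻ π _ G iso (JoinMatch.connected-sideˡ G0 G1 σ (connected-block h₀ k))

connected-∁block : ∀ {n H} (h : InH4 n H) k → Connected H (not ∘ block h k)
connected-∁block (base _ _ _) k _ _ ()
connected-∁block {suc n} (step G0 G1 _ h₁ σ G π iso) k with suc n ≤? k
... | yes _ = λ _ _ ()
... | no  _ = connected-iso⁻ π _ G iso (JoinMatch.connected-∁sideˡ G0 G1 σ (connected h₁) _)

sumList-tabulate : ∀ {N} (f : Fin N → ℕ) → sumList (List.tabulate f) ≡ ∑[ i < N ] f i
sumList-tabulate {zero}  f = refl
sumList-tabulate {suc N} f = cong (f zero +_) (sumList-tabulate (f ∘ suc))

sumList-allFin : ∀ {N} (f : Fin N → ℕ) → sumList (List.map f (List.allFin N)) ≡ ∑[ i < N ] f i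
sumList-allFin f = trans (cong sumList (List.map-tabulate (λ i → i) f)) (sumList-tabulate f)

cutSize≡cut : ∀ {N} (G : Graph N) X → cutSize G X ≡ cut G (mem X)
cutSize≡cut {N} G X = trans (sumList-allFin (λ u → sumList (List.map (crossing u) (List.allFin N))))
                              (sum-cong-≗ λ u → sumList-allFin (crossing u))
  where
  crossing : Fin N → Fin N → ℕ
  crossing u v = ⟦ mem X u ∧ not (mem X v) ∧ G u v ⟧

∣∣≡count : ∀ {N} (X : Subset N) → ∣ X ∣ ≡ count (mem X)
∣∣≡count []          = refl
∣∣≡count (true  ∷ X) = cong suc (∣∣≡count X)
∣∣≡count (false ∷ X) = ∣∣≡count X

walk⇒pathIn : ∀ {N} {G : Graph N} {X u w} → Walk G (mem X) u w → PathIn G X u w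
walk⇒pathIn here           = here
walk⇒pathIn (next e xv w₁) = next e (lookup⇒[]= _ _ (T⇒≡true xv)) (walk⇒pathIn w₁)
  where
  T⇒≡true : ∀ {b} → T b → b ≡ true
  T⇒≡true {true} _ = refl

connectedIn : ∀ {N} {G : Graph N} {X} → Connected G (mem X) → ConnectedIn G X
connectedIn {X = X} conn u w u∈ w∈ = walk⇒pathIn (conn u w (∈⇒T u∈) (∈⇒T w∈))
  where
  ∈⇒T : ∀ {v} → v ∈ X → T (mem X v)
  ∈⇒T v∈ = subst T (sym ([]=⇒lookup v∈)) tt

admissible-tabulate : ∀ {N} {G : Graph N} {p} → Connected G p → Connected G (not ∘ p) →
                      Admissible G (count p) (tabulate p)
admissible-tabulate {p = p} conn conn∁ =
    trans (∣∣≡count (tabulate p)) (sum-cong-≗ (cong ⟦_⟧ ∘ lookup∘tabulate p))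
  , connectedIn (connected-≗ (sym ∘ lookup∘tabulate p) conn)
  , connectedIn (connected-≗ (λ u → sym (trans (lookup-map u not (tabulate p)) (cong not (lookup∘tabulate p u)))) conn∁)

cut-tabulate : ∀ {N} (G : Graph N) p → cutSize G (tabulate p) ≡ cut G p
cut-tabulate G p = trans (cutSize≡cut G (tabulate p)) (sum-cong-≗ λ u → sum-cong-≗ λ v →
  cong₂ (λ x y → ⟦ x ∧ not y ∧ G u v ⟧) (lookup∘tabulate p u) (lookup∘tabulate p v))

-- Comparing cuts

cut-lower-bound : ∀ {n H} → InH4 n H → ∀ p → suc n * count p ≤ cut H p + 2 * ex (count p)
cut-lower-bound {n} {H} h p = begin
  suc n * count p              ≡⟨ inner+cut≡ (regular h) p ⟨
  inner H p + cut H p          ≤⟨ +-monoˡ-≤ (cut H p) (inner≤2ex h p) ⟩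
  2 * ex (count p) + cut H p   ≡⟨ +-comm _ (cut H p) ⟩
  cut H p + 2 * ex (count p)   ∎
  where open ≤-Reasoning

cut-block-upper : ∀ {n H} (h : InH4 n H) {k} → 2 ≤ k → k ≤ n → cut H (block h k) + suc k * 2 ^ k ≤ suc n * 2 ^ k
cut-block-upper {n} {H} h {k} 2≤k k≤n = begin
  cut H B + suc k * 2 ^ k      ≡⟨ cong (λ c → cut H B + suc k * c) (count-block h 2≤k k≤n) ⟨
  cut H B + suc k * count B    ≤⟨ +-monoʳ-≤ (cut H B) (*count≤inner (minDegree-block h k≤n)) ⟩
  cut H B + inner H B          ≡⟨ +-comm (cut H B) (inner H B) ⟩
  inner H B + cut H B          ≡⟨ inner+cut≡ (regular h) B ⟩
  suc n * count B              ≡⟨ cong (suc n *_) (count-block h 2≤k k≤n) ⟩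
  suc n * 2 ^ k                ∎
  where
  open ≤-Reasoning
  B = block h k

cut-block≤cut : ∀ {n H} (h : InH4 n H) q {m j r} → 2 + q ≤ n → m + j ≡ size q → 2 * ex j ≤ j * r →
                suc n + r ≡ 2 * (3 + q) → ∀ p → count p ≡ m → cut H (block h (2 + q)) ≤ cut H p
cut-block≤cut {n} {H} h q {m} {j} {r} k≤n m+j≡K 2ex≤jr n+r≡ p count≡m = +-cancelʳ-≤ (S * K + 2 * ex m) _ _ (begin
  cut H B + (S * K + 2 * ex m)   ≡⟨ +-assoc (cut H B) (S * K) (2 * ex m) ⟨
  cut H B + S * K + 2 * ex m     ≤⟨ +-monoˡ-≤ (2 * ex m) (cut-block-upper h (s≤s (s≤s z≤n)) k≤n) ⟩
  suc n * K + 2 * ex m           ≤⟨ cut-comparison q {m} {j} {r} {suc n} m+j≡K 2ex≤jr n+r≡ ⟩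
  suc n * m + S * K              ≤⟨ +-monoˡ-≤ (S * K) cut-p≥ ⟩
  cut H p + 2 * ex m + S * K     ≡⟨ +-assoc (cut H p) (2 * ex m) (S * K) ⟩
  cut H p + (2 * ex m + S * K)   ≡⟨ cong (cut H p +_) (+-comm (2 * ex m) (S * K)) ⟩
  cut H p + (S * K + 2 * ex m)   ∎)
  where
  open ≤-Reasoning
  B = block h (2 + q)
  K = size q
  S = 3 + q
  cut-p≥ : suc n * m ≤ cut H p + 2 * ex m
  cut-p≥ = subst (λ c → suc n * c ≤ cut H p + 2 * ex c) count≡m (cut-lower-bound h p)

block-admissible : ∀ {n H} (h : InH4 n H) {k} → 2 ≤ k → k ≤ n → Admissible H (2 ^ k) (tabulate (block h k))
block-admissible {H = H} h {k} 2≤k k≤n =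
  subst (λ c → Admissible H c (tabulate (block h k))) (count-block h 2≤k k≤n)
        (admissible-tabulate (connected-block h k) (connected-∁block h k))

⌈n/2⌉+⌈n/2⌉≡n+n%2 : ∀ n → ⌈ n /2⌉ + ⌈ n /2⌉ ≡ n + n % 2
⌈n/2⌉+⌈n/2⌉≡n+n%2 0             = refl
⌈n/2⌉+⌈n/2⌉≡n+n%2 1             = refl
⌈n/2⌉+⌈n/2⌉≡n+n%2 (suc (suc n)) = cong suc (trans (+-suc ⌈ n /2⌉ ⌈ n /2⌉) (cong suc (⌈n/2⌉+⌈n/2⌉≡n+n%2 n)))

⌈n/2⌉+t≤n : ∀ n {t} → t + 1 ≤ ⌊ n /2⌋ → ⌈ n /2⌉ + t ≤ n
⌈n/2⌉+t≤n n {t} t+1≤ = ≤-trans (+-monoʳ-≤ ⌈ n /2⌉ (≤-trans (m≤m+n t 1) t+1≤))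
                               (≤-reflexive (trans (+-comm ⌈ n /2⌉ ⌊ n /2⌋) (⌊n/2⌋+⌈n/2⌉≡n n)))

g≡ceil3 : ∀ n t → g n t ≡ ceil3 (2 ^ suc (2 * t + 1 + γ n))
g≡ceil3 n t = cong (λ e → ceil3 (2 ^ e)) (regroup t (γ n))
  where
  regroup : ∀ t c → 2 * t + 2 + c ≡ suc (2 * t + 1 + c)
  regroup = solve-∀

degree+γ-exponent : ∀ n t → suc n + (2 * t + 1 + γ n) ≡ 2 * suc (⌈ n /2⌉ + t)
degree+γ-exponent n t = begin
  suc n + (2 * t + 1 + γ n)        ≡⟨ regroup n t (γ n) ⟩
  n + γ n + 2 * t + 2              ≡⟨ cong (λ x → x + 2 * t + 2) (⌈n/2⌉+⌈n/2⌉≡n+n%2 n) ⟨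
  ⌈ n /2⌉ + ⌈ n /2⌉ + 2 * t + 2    ≡⟨ regroup′ ⌈ n /2⌉ t ⟩
  2 * suc (⌈ n /2⌉ + t)            ∎
  where
  open ≡-Reasoning
  regroup : ∀ n t c → suc n + (2 * t + 1 + c) ≡ n + c + 2 * t + 2
  regroup = solve-∀
  regroup′ : ∀ c t → c + c + 2 * t + 2 ≡ 2 * suc (c + t)
  regroup′ = solve-∀

lemma4p5 : ∀ (n : ℕ) → 3 ≤ n → (H : Graph (2 ^ n)) → InH4 n H →
    ∀ (t : ℕ) → t + 1 ≤ ⌊ n /2⌋ →
    ∀ (m : ℕ) → 2 ^ (⌈ n /2⌉ + t) ≤ m + g n t → m ≤ 2 ^ (⌈ n /2⌉ + t) →
    ∀ (a b : ℕ) → IsXi H m a → IsXi H (2 ^ (⌈ n /2⌉ + t)) b → b ≤ a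
lemma4p5 .(3 + n′) (s≤s (s≤s (s≤s {n = n′} _))) H h t t+1≤⌊n/2⌋ m K≤m+g m≤K a b
         ((X , (∣X∣≡m , _) , cutX≡a) , _) (_ , minimal) = begin
  b                        ≤⟨ minimal (tabulate B) (block-admissible h (s≤s (s≤s z≤n)) k≤n) ⟩
  cutSize H (tabulate B)   ≡⟨ cut-tabulate H B ⟩
  cut H B                  ≤⟨ cut-block≤cut h q k≤n (m+[n∸m]≡n m≤K) (ex-third r j≤) (degree+γ-exponent n t)
                                            (mem X) count≡m ⟩
  cut H (mem X)            ≡⟨ cutSize≡cut H X ⟨
  cutSize H X              ≡⟨ cutX≡a ⟩
  a                        ∎
  where
  open ≤-Reasoning
  n = 3 + n′
  -- 2 + q computes to ⌈ n /2⌉ + t, so size q is 2 ^ (⌈ n /2⌉ + t).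
  q = ⌊ n′ /2⌋ + t
  r = 2 * t + 1 + γ n
  B = block h (2 + q)
  k≤n : 2 + q ≤ n
  k≤n = ⌈n/2⌉+t≤n n t+1≤⌊n/2⌋
  j≤ : size q ∸ m ≤ ceil3 (2 ^ suc r)
  j≤ = subst (size q ∸ m ≤_) (g≡ceil3 n t) (m≤n+o⇒m∸n≤o (size q) m K≤m+g)
  count≡m : count (mem X) ≡ m
  count≡m = trans (sym (∣∣≡count X)) ∣X∣≡m
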